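{- Let $(\mathcal{X},d)$ be a finite metric space, $\mathcal{P}=\{P_1,\dots,P_t\}$ a partition of $\mathcal{X}$ into nonempty parts, and $b\ge 0$ an integer budget. For each $i\in[t]$, run the greedy farthest-point procedure on $P_i$ for $b+1$ steps, let $R_{i,j}$ be the set of the first $j$ points it selects, and set $\hat c_i(j)=\mathrm{cost}(P_i,R_{i,j})$ for $j\in[b+1]$. Let $\{\hat b_i : i\in[t]\}$ be an optimal solution to $$\min \sum_{i=1}^t \hat c_i(b_i+1)\quad\text{subject to}\quad \sum_{i=1}^t b_i=b,\ b_i\in\{0,1,2,\dots\}\ \forall i\in[t],$$ and for each $i\in[t]$ let $R_i=R_{i,\hat b_i+1}$ be the first $\hat b_i+1$ points selected by the greedy procedure on $P_i$. Then $\{R_i : i\in[t]\}$ is a $2$-approximate solution to the Best Representatives problem, i.e. it is feasible and $\sum_{i=1}^t \mathrm{cost}(P_i,R_i)$ is at most twice the optimal value of that problem.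
   Context: For $R_i\subseteq P_i$ nonempty, $\mathrm{cost}(P_i,R_i)=\max_{x\in P_i}\min_{r\in R_i} d(x,r)$, and for $R=\{R_i\}$, $\mathrm{cost}(\mathcal{P},R)=\sum_{i=1}^t\mathrm{cost}(P_i,R_i)$. The Best Representatives problem with budget $b$ is: minimize $\mathrm{cost}(\mathcal{P},R)=\sum_{i=1}^t \max_{x\in P_i}\min_{r\in R_i} d(x,r)$ over choices of subsets $R_i\subseteq P_i$ subject to $|R_i|\ge 1$ for all $i\in[t]$ and $\sum_{i=1}^t(|R_i|-1)\le b$. The greedy farthest-point procedure (Gonzalez's algorithm for $k$-center) on a set $P$: choose an arbitrary first point of $P$; at each subsequent step $j$, choose a point of $P$ whose distance to the nearest of the previously chosen $j-1$ points is maximum.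
   Formalization: The distances d of the finite metric space take rational values instead of real ones. -}

module Defs where

open import Data.Nat as ℕ using (ℕ; zero; suc; _∸_; _<ᵇ_)
open import Data.Bool using (Bool; true; false; _∧_)
open import Data.Fin as Fin using (Fin; toℕ)
open import Data.Fin.Subset using (Subset; _∈_; _⊆_; Nonempty; ∣_∣)
open import Data.Fin.Subset.Properties using (_∈?_)
open import Data.List as List using (List; []; _∷_; map; foldr; filter; allFin)
open import Data.Bool.ListAction using (any)
open import Data.Vec using (tabulate)
open import Data.Product using (_×_; ∃)
open import Data.Rational using (ℚ; 0ℚ; _+_; _≤_; _⊔_; _⊓_)
open import Relation.Nullary.Decidable using (⌊_⌋)
open import Relation.Binary.PropositionalEquality using (_≡_)

record IsMetric {n : ℕ} (d : Fin n → Fin n → ℚ) : Set where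
  field
    nonneg   : ∀ x y → 0ℚ ≤ d x y
    self     : ∀ x → d x x ≡ 0ℚ
    separate : ∀ x y → d x y ≡ 0ℚ → x ≡ y
    symm     : ∀ x y → d x y ≡ d y x
    triangle : ∀ x y z → d x z ≤ d x y + d y z

elems : ∀ {n} → Subset n → List (Fin n)
elems S = filter (_∈? S) (allFin _)

-- minimum / maximum of a list of rationals (value on the empty list is
-- irrelevant: it is only ever used on nonempty lists)
minList : List ℚ → ℚ
minList [] = 0ℚ
minList (q ∷ qs) = foldr _⊓_ q qs

maxList : List ℚ → ℚ
maxList [] = 0ℚ
maxList (q ∷ qs) = foldr _⊔_ q qs

distTo : ∀ {n} → (Fin n → Fin n → ℚ) → Fin n → Subset n → ℚ
distTo d x R = minList (map (d x) (elems R))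

cost : ∀ {n} → (Fin n → Fin n → ℚ) → Subset n → Subset n → ℚ
cost d P R = maxList (map (λ x → distTo d x R) (elems P))

sumℕ : ∀ {t} → (Fin t → ℕ) → ℕ
sumℕ f = foldr ℕ._+_ 0 (map f (allFin _))

sumℚ : ∀ {t} → (Fin t → ℚ) → ℚ
sumℚ f = foldr _+_ 0ℚ (map f (allFin _))

-- the part P_i of the partition given by the labelling part : X → [t]
Part : ∀ {n t} → (Fin n → Fin t) → Fin t → Subset n
Part part i = tabulate (λ x → ⌊ part x Fin.≟ i ⌋)

prefixSet : ∀ {m n} → (Fin m → Fin n) → ℕ → Subset n
prefixSet g k = tabulate (λ x → any (λ j → (toℕ j <ᵇ k) ∧ ⌊ g j Fin.≟ x ⌋) (allFin _))

-- g : [b+1] → P is a run of the greedy farthest-point (Gonzalez) procedure on P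
-- for b+1 steps: the first point is an arbitrary point of P, and each later point
-- g j (j ≥ 1) maximises over P the distance to the set of previously chosen points.
IsGreedy : ∀ {n} → (Fin n → Fin n → ℚ) → Subset n → (b : ℕ) → (Fin (suc b) → Fin n) → Set
IsGreedy d P b g =
  (∀ j → g j ∈ P) ×
  (∀ (j : Fin (suc b)) → 1 ℕ.≤ toℕ j → ∀ y → y ∈ P →
     distTo d y (prefixSet g (toℕ j)) ≤ distTo d (g j) (prefixSet g (toℕ j)))

cHat : ∀ {n t} (d : Fin n → Fin n → ℚ) (part : Fin n → Fin t) {b : ℕ}
       (g : Fin t → Fin (suc b) → Fin n) → Fin t → ℕ → ℚ
cHat d part g i j = cost d (Part part i) (prefixSet (g i) j)

OptimalAlloc : ∀ {n} {t} (d : Fin n → Fin n → ℚ) (part : Fin n → Fin t) (b : ℕ)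
               (g : Fin t → Fin (suc b) → Fin n) → (Fin t → ℕ) → Set
OptimalAlloc d part b g bh =
  sumℕ bh ≡ b ×
  (∀ (bs : Fin _ → ℕ) → sumℕ bs ≡ b →
     sumℚ (λ i → cHat d part g i (suc (bh i))) ≤ sumℚ (λ i → cHat d part g i (suc (bs i))))

Feasible : ∀ {n t} → (Fin n → Fin t) → ℕ → (Fin t → Subset n) → Set
Feasible part b R =
  (∀ i → R i ⊆ Part part i) ×
  (∀ i → Nonempty (R i)) ×
  sumℕ (λ i → ∣ R i ∣ ∸ 1) ℕ.≤ b

totalCost : ∀ {n t} → (Fin n → Fin n → ℚ) → (Fin n → Fin t) → (Fin t → Subset n) → ℚ
totalCost d part R = sumℚ (λ i → cost d (Part part i) (R i))

{-# OPTIONS --safe #-}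
-- Gonzalez's argument: let x be the point of P farthest from the first k greedy points and
-- r = cost(P, R_k). Each greedy point was at least as far from its predecessors as x is from
-- them, so x and the k greedy points are pairwise at distance at least r. If S has at most k
-- points, two of these k + 1 points share a nearest point of S, whence r ≤ 2 cost(P, S).
-- For a feasible competitor R', the allocation ∣R'ᵢ∣ - 1, padded to total exactly b, is a
-- candidate for the optimal allocation b̂; applying the bound in each part gives the factor 2.
module Submission where

open import Defs
open import Data.Nat as ℕ using (ℕ; zero; suc; _∸_; z≤n; s≤s)
import Data.Nat.Properties as ℕ
open import Data.Bool using (Bool; T)
open import Data.Bool.Properties using (T-≡; T-∧)
open import Data.Fin as Fin using (Fin; toℕ; inject≤)
open import Data.Fin.Properties
  using (pigeonhole; injective⇒≤; toℕ-inject≤; toℕ<n; toℕ-injective; suc-injective; fromℕ<-injective)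
open import Data.Fin.Subset using (Subset; _∈_; _⊆_; Nonempty; ∣_∣; inside; outside)
open import Data.Fin.Subset.Properties using (_∈?_)
open import Data.List using ([]; _∷_; map; foldr; allFin)
open import Data.List.Properties using (map-tabulate)
open import Data.List.Membership.Propositional using (lose) renaming (_∈_ to _∈ˡ_)
open import Data.List.Membership.Propositional.Properties
  using (∈-filter⁺; ∈-filter⁻; ∈-allFin; ∈-map⁺; ∈-map⁻; foldr-selective)
open import Data.List.Relation.Unary.Any using (here; there; satisfied)
open import Data.List.Relation.Unary.Any.Properties using (any⁺; any⁻)
open import Data.Vec using (_∷_; tabulate; here; there)
open import Data.Vec.Properties using (lookup∘tabulate; []=⇒lookup; lookup⇒[]=)
open import Data.Product using (_×_; ∃; ∃₂; _,_; proj₁; proj₂)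
open import Data.Sum using ([_,_]′)
open import Data.Rational using (ℚ; 0ℚ; _+_; _≤_; _⊓_; _⊔_)
import Data.Rational.Properties as ℚ
open import Algebra.Bundles using (CommutativeMonoid)
import Algebra.Properties.CommutativeSemigroup as CommSemigroupProperties
open import Function using (_∘_; id; Equivalence)
open import Relation.Nullary.Decidable using (toWitness; fromWitness)
open import Relation.Binary.PropositionalEquality
  using (_≡_; refl; sym; trans; cong; cong₂; subst; subst₂; module ≡-Reasoning)
open Equivalence using (to; from)

private
  variable
    m n k t : ℕ

foldr-⊓-≤ : ∀ e xs {q} → q ∈ˡ e ∷ xs → foldr _⊓_ e xs ≤ q
foldr-⊓-≤ e []       (here refl)         = ℚ.≤-refl
foldr-⊓-≤ e (x ∷ xs) (here refl)         = ℚ.≤-trans (ℚ.p⊓q≤q x _) (foldr-⊓-≤ e xs (here refl))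
foldr-⊓-≤ e (x ∷ xs) (there (here refl)) = ℚ.p⊓q≤p x _
foldr-⊓-≤ e (x ∷ xs) (there (there q∈)) = ℚ.≤-trans (ℚ.p⊓q≤q x _) (foldr-⊓-≤ e xs (there q∈))

foldr-⊔-≥ : ∀ e xs {q} → q ∈ˡ e ∷ xs → q ≤ foldr _⊔_ e xs
foldr-⊔-≥ e []       (here refl)         = ℚ.≤-refl
foldr-⊔-≥ e (x ∷ xs) (here refl)         = ℚ.≤-trans (foldr-⊔-≥ e xs (here refl)) (ℚ.p≤q⊔p x _)
foldr-⊔-≥ e (x ∷ xs) (there (here refl)) = ℚ.p≤p⊔q x _
foldr-⊔-≥ e (x ∷ xs) (there (there q∈)) = ℚ.≤-trans (foldr-⊔-≥ e xs (there q∈)) (ℚ.p≤q⊔p x _)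

minList-≤ : ∀ {qs q} → q ∈ˡ qs → minList qs ≤ q
minList-≤ {p ∷ ps} = foldr-⊓-≤ p ps

minList-∈ : ∀ {qs q} → q ∈ˡ qs → minList qs ∈ˡ qs
minList-∈ {p ∷ ps} _ = [ here , there ]′ (foldr-selective ℚ.⊓-sel p ps)

≤-maxList : ∀ {qs q} → q ∈ˡ qs → q ≤ maxList qs
≤-maxList {p ∷ ps} = foldr-⊔-≥ p ps

maxList-∈ : ∀ {qs q} → q ∈ˡ qs → maxList qs ∈ˡ qs
maxList-∈ {p ∷ ps} _ = [ here , there ]′ (foldr-selective ℚ.⊔-sel p ps)

∈-elems⁺ : {S : Subset n} {x : Fin n} → x ∈ S → x ∈ˡ elems S
∈-elems⁺ {S = S} {x} = ∈-filter⁺ (_∈? S) (∈-allFin x)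

∈-elems⁻ : {S : Subset n} {x : Fin n} → x ∈ˡ elems S → x ∈ S
∈-elems⁻ {S = S} = proj₂ ∘ ∈-filter⁻ (_∈? S) {xs = allFin _}

∈-tabulate⁺ : {p : Fin n → Bool} {x : Fin n} → T (p x) → x ∈ tabulate p
∈-tabulate⁺ {p = p} {x} px = lookup⇒[]= x (tabulate p) (trans (lookup∘tabulate p x) (to T-≡ px))

∈-tabulate⁻ : {p : Fin n → Bool} {x : Fin n} → x ∈ tabulate p → T (p x)
∈-tabulate⁻ {p = p} {x} x∈ = from T-≡ (trans (sym (lookup∘tabulate p x)) ([]=⇒lookup x∈))

∈-Part : (part : Fin n → Fin t) {x : Fin n} {i : Fin t} → part x ≡ i → x ∈ Part part i
∈-Part part = ∈-tabulate⁺ ∘ fromWitness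

module _ (g : Fin m → Fin n) where

  ∈-prefixSet⁺ : ∀ {k} j → toℕ j ℕ.< k → g j ∈ prefixSet g k
  ∈-prefixSet⁺ j j<k =
    ∈-tabulate⁺ (any⁺ _ (lose (∈-allFin j) (from T-∧ (ℕ.<⇒<ᵇ j<k , fromWitness refl))))

  ∈-prefixSet⁻ : ∀ {k x} → x ∈ prefixSet g k → ∃ λ j → toℕ j ℕ.< k × g j ≡ x
  ∈-prefixSet⁻ x∈ with satisfied (any⁻ _ (allFin m) (∈-tabulate⁻ x∈))
  ... | j , j-ok with to T-∧ j-ok
  ...   | j<ᵇk , gj≡x = j , ℕ.<ᵇ⇒< _ _ j<ᵇk , toWitness gj≡x

  prefixSet-mono : ∀ {k₁ k₂} → k₁ ℕ.≤ k₂ → prefixSet g k₁ ⊆ prefixSet g k₂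
  prefixSet-mono k₁≤k₂ x∈ with ∈-prefixSet⁻ x∈
  ... | j , j<k₁ , refl = ∈-prefixSet⁺ j (ℕ.<-≤-trans j<k₁ k₁≤k₂)

rank : {S : Subset n} {x : Fin n} → x ∈ S → Fin ∣ S ∣
rank {S = inside ∷ S}  here       = Fin.zero
rank {S = inside ∷ S}  (there x∈) = Fin.suc (rank x∈)
rank {S = outside ∷ S} (there x∈) = rank x∈

rank-injective : {S : Subset n} {x y : Fin n} (x∈ : x ∈ S) (y∈ : y ∈ S) →
  rank x∈ ≡ rank y∈ → x ≡ y
rank-injective {S = inside ∷ S}  here       here       _ = refl
rank-injective {S = inside ∷ S}  (there x∈) (there y∈) r≡ =
  cong Fin.suc (rank-injective x∈ y∈ (suc-injective r≡))
rank-injective {S = outside ∷ S} (there x∈) (there y∈) r≡ = cong Fin.suc (rank-injective x∈ y∈ r≡)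

unrank : (S : Subset n) → Fin ∣ S ∣ → Fin n
unrank (inside ∷ S)  Fin.zero    = Fin.zero
unrank (inside ∷ S)  (Fin.suc i) = Fin.suc (unrank S i)
unrank (outside ∷ S) i           = Fin.suc (unrank S i)

unrank-∈ : (S : Subset n) (i : Fin ∣ S ∣) → unrank S i ∈ S
unrank-∈ (inside ∷ S)  Fin.zero    = here
unrank-∈ (inside ∷ S)  (Fin.suc i) = there (unrank-∈ S i)
unrank-∈ (outside ∷ S) i           = there (unrank-∈ S i)

unrank-injective : (S : Subset n) {i j : Fin ∣ S ∣} → unrank S i ≡ unrank S j → i ≡ j
unrank-injective (inside ∷ S)  {Fin.zero}  {Fin.zero}  _  = refl
unrank-injective (inside ∷ S)  {Fin.suc i} {Fin.suc j} u≡ = cong Fin.suc (unrank-injective S (suc-injective u≡))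
unrank-injective (outside ∷ S) u≡ = unrank-injective S (suc-injective u≡)

pigeonhole-∈ : {S : Subset n} → ∣ S ∣ ℕ.< m → (h : Fin m → Fin n) → (∀ i → h i ∈ S) →
  ∃₂ λ i j → i Fin.< j × h i ≡ h j
pigeonhole-∈ ∣S∣<m h h∈ with pigeonhole ∣S∣<m (rank ∘ h∈)
... | i , j , i<j , rank≡ = i , j , i<j , rank-injective (h∈ i) (h∈ j) rank≡

covering⇒∣∣≤ : (S : Subset n) (h : Fin m → Fin n) →
  (∀ {x} → x ∈ S → ∃ λ j → toℕ j ℕ.< k × h j ≡ x) → ∣ S ∣ ℕ.≤ k
covering⇒∣∣≤ S h cover = injective⇒≤ {f = index} index-injective
  where
  position : Fin ∣ S ∣ → Fin _
  position i = proj₁ (cover (unrank-∈ S i))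
  position<k : ∀ i → toℕ (position i) ℕ.< _
  position<k i = proj₁ (proj₂ (cover (unrank-∈ S i)))
  h-position : ∀ i → h (position i) ≡ unrank S i
  h-position i = proj₂ (proj₂ (cover (unrank-∈ S i)))
  index : Fin ∣ S ∣ → Fin _
  index i = Fin.fromℕ< (position<k i)
  index-injective : ∀ {i j} → index i ≡ index j → i ≡ j
  index-injective {i} {j} index≡ = unrank-injective S (begin
    unrank S i     ≡⟨ sym (h-position i) ⟩
    h (position i) ≡⟨ cong h (toℕ-injective (fromℕ<-injective _ _ (position<k i) (position<k j) index≡)) ⟩
    h (position j) ≡⟨ h-position j ⟩
    unrank S j     ∎)
    where open ≡-Reasoning

∣prefixSet∣≤ : (g : Fin m → Fin n) (k : ℕ) → ∣ prefixSet g k ∣ ℕ.≤ k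
∣prefixSet∣≤ g k = covering⇒∣∣≤ (prefixSet g k) g (∈-prefixSet⁻ g)

module _ (d : Fin n → Fin n → ℚ) where

  distTo-≤ : ∀ x {R r} → r ∈ R → distTo d x R ≤ d x r
  distTo-≤ x r∈R = minList-≤ (∈-map⁺ (d x) (∈-elems⁺ r∈R))

  nearest : ∀ x {R} → Nonempty R → ∃ λ r → r ∈ R × distTo d x R ≡ d x r
  nearest x (_ , r∈R) with ∈-map⁻ (d x) (minList-∈ (∈-map⁺ (d x) (∈-elems⁺ r∈R)))
  ... | r , r∈elems , eq = r , ∈-elems⁻ r∈elems , eq

  nearest-centres : ∀ {R} (f : Fin m → Fin n) → Nonempty R →
    ∃ λ centre → (∀ i → centre i ∈ R) × (∀ i → distTo d (f i) R ≡ d (f i) (centre i))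
  nearest-centres f R≢∅ =
    proj₁ ∘ near , proj₁ ∘ proj₂ ∘ near , proj₂ ∘ proj₂ ∘ near
    where near = λ i → nearest (f i) R≢∅

  distTo-antitone : ∀ x {R₁ R₂} → R₁ ⊆ R₂ → Nonempty R₁ → distTo d x R₂ ≤ distTo d x R₁
  distTo-antitone x R₁⊆R₂ R₁≢∅ with nearest x R₁≢∅
  ... | r , r∈R₁ , eq = ℚ.≤-trans (distTo-≤ x (R₁⊆R₂ r∈R₁)) (ℚ.≤-reflexive (sym eq))

  distTo-≤-cost : ∀ {P} R {x} → x ∈ P → distTo d x R ≤ cost d P R
  distTo-≤-cost R {x} x∈P = ≤-maxList (∈-map⁺ (λ y → distTo d y R) (∈-elems⁺ x∈P))

  farthest : ∀ {P} R → Nonempty P → ∃ λ x → x ∈ P × cost d P R ≡ distTo d x R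
  farthest R (_ , x∈P)
    with ∈-map⁻ (λ y → distTo d y R) (maxList-∈ (∈-map⁺ (λ y → distTo d y R) (∈-elems⁺ x∈P)))
  ... | x , x∈elems , eq = x , ∈-elems⁻ x∈elems , eq

module _ {d : Fin n → Fin n → ℚ} (metric : IsMetric d) where
  open IsMetric metric

  separated-≤-double-radius : ∀ {r ρ S} (f : Fin (suc k) → Fin n) →
    (∀ {i j} → i Fin.< j → r ≤ d (f i) (f j)) →
    Nonempty S → ∣ S ∣ ℕ.≤ k → (∀ i → distTo d (f i) S ≤ ρ) → r ≤ ρ + ρ
  separated-≤-double-radius {r = r} {ρ} {S} f separated S≢∅ ∣S∣≤k covered
    with nearest-centres d f S≢∅
  ... | centre , centre∈S , distTo-centre
    with pigeonhole-∈ (s≤s ∣S∣≤k) centre centre∈S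
  ... | i , j , i<j , same-centre = begin
    r                                       ≤⟨ separated i<j ⟩
    d (f i) (f j)                           ≤⟨ triangle (f i) (centre j) (f j) ⟩
    d (f i) (centre j) + d (centre j) (f j) ≡⟨ cong₂ _+_ (cong (d (f i)) (sym same-centre)) (symm _ _) ⟩
    d (f i) (centre i) + d (f j) (centre j) ≡⟨ sym (cong₂ _+_ (distTo-centre i) (distTo-centre j)) ⟩
    distTo d (f i) S + distTo d (f j) S     ≤⟨ ℚ.+-mono-≤ (covered i) (covered j) ⟩
    ρ + ρ                                   ∎
    where open ℚ.≤-Reasoning

  module _ {P : Subset n} {b : ℕ} {g : Fin (suc b) → Fin n} (greedy : IsGreedy d P b g) where

    greedy-far : ∀ {a c y} → toℕ a ℕ.< toℕ c → y ∈ P →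
      distTo d y (prefixSet g (toℕ c)) ≤ d (g a) (g c)
    greedy-far {a} {c} {y} a<c y∈P = begin
      distTo d y (prefixSet g (toℕ c))     ≤⟨ proj₂ greedy c (ℕ.≤-trans (s≤s z≤n) a<c) y y∈P ⟩
      distTo d (g c) (prefixSet g (toℕ c)) ≤⟨ distTo-≤ d (g c) (∈-prefixSet⁺ g a a<c) ⟩
      d (g c) (g a)                        ≡⟨ symm (g c) (g a) ⟩
      d (g a) (g c)                        ∎
      where open ℚ.≤-Reasoning

    gonzalez-2-approx : ∀ {k S} → Nonempty P → k ℕ.≤ suc b → Nonempty S → ∣ S ∣ ℕ.≤ k →
      cost d P (prefixSet g k) ≤ cost d P S + cost d P S
    gonzalez-2-approx {k} {S} P≢∅ k≤1+b S≢∅ ∣S∣≤k with farthest d (prefixSet g k) P≢∅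
    ... | x , x∈P , cost≡distTo =
      separated-≤-double-radius points separated S≢∅ ∣S∣≤k (λ i → distTo-≤-cost d S (points-∈ i))
      where
      open ℚ.≤-Reasoning
      R = prefixSet g k

      index : Fin k → Fin (suc b)
      index j = inject≤ j k≤1+b

      index<k : ∀ j → toℕ (index j) ℕ.< k
      index<k j = subst (ℕ._< k) (sym (toℕ-inject≤ j k≤1+b)) (toℕ<n j)

      points : Fin (suc k) → Fin n
      points Fin.zero    = x
      points (Fin.suc j) = g (index j)

      points-∈ : ∀ i → points i ∈ P
      points-∈ Fin.zero    = x∈P
      points-∈ (Fin.suc j) = proj₁ greedy (index j)

      separated : ∀ {i j} → i Fin.< j → cost d P R ≤ d (points i) (points j)
      separated {Fin.zero} {Fin.suc j} _ = begin
        cost d P R   ≡⟨ cost≡distTo ⟩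
        distTo d x R ≤⟨ distTo-≤ d x (∈-prefixSet⁺ g (index j) (index<k j)) ⟩
        d x (g (index j)) ∎
      separated {Fin.suc i} {Fin.suc j} (s≤s i<j) = begin
        cost d P R                                ≡⟨ cost≡distTo ⟩
        distTo d x R                              ≤⟨ distTo-antitone d x R-earlier⊆R (g (index i) , i∈R-earlier) ⟩
        distTo d x (prefixSet g (toℕ (index j))) ≤⟨ greedy-far index-i<index-j x∈P ⟩
        d (g (index i)) (g (index j))             ∎
        where
        index-i<index-j : toℕ (index i) ℕ.< toℕ (index j)
        index-i<index-j = subst₂ ℕ._<_ (sym (toℕ-inject≤ i k≤1+b)) (sym (toℕ-inject≤ j k≤1+b)) i<j
        R-earlier⊆R : prefixSet g (toℕ (index j)) ⊆ R
        R-earlier⊆R = prefixSet-mono g (ℕ.<⇒≤ (index<k j))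
        i∈R-earlier : g (index i) ∈ prefixSet g (toℕ (index j))
        i∈R-earlier = ∈-prefixSet⁺ g (index i) index-i<index-j

foldr-map-allFin-suc : {A : Set} (_∙_ : A → A → A) (e : A) (f : Fin (suc t) → A) →
  foldr _∙_ e (map f (allFin (suc t))) ≡ f Fin.zero ∙ foldr _∙_ e (map (f ∘ Fin.suc) (allFin t))
foldr-map-allFin-suc {t} _∙_ e f = cong (λ xs → f Fin.zero ∙ foldr _∙_ e xs)
  (trans (map-tabulate Fin.suc f) (sym (map-tabulate id (f ∘ Fin.suc))))

sumℕ-suc : (f : Fin (suc t) → ℕ) → sumℕ f ≡ f Fin.zero ℕ.+ sumℕ (f ∘ Fin.suc)
sumℕ-suc = foldr-map-allFin-suc ℕ._+_ 0

sumℚ-suc : (f : Fin (suc t) → ℚ) → sumℚ f ≡ f Fin.zero + sumℚ (f ∘ Fin.suc)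
sumℚ-suc = foldr-map-allFin-suc _+_ 0ℚ

sumℕ-mono : {f g : Fin t → ℕ} → (∀ i → f i ℕ.≤ g i) → sumℕ f ℕ.≤ sumℕ g
sumℕ-mono {zero}          f≤g = z≤n
sumℕ-mono {suc t} {f} {g} f≤g rewrite sumℕ-suc f | sumℕ-suc g =
  ℕ.+-mono-≤ (f≤g Fin.zero) (sumℕ-mono (f≤g ∘ Fin.suc))

≤-sumℕ : (f : Fin t → ℕ) (i : Fin t) → f i ℕ.≤ sumℕ f
≤-sumℕ {suc t} f Fin.zero    rewrite sumℕ-suc f = ℕ.m≤m+n _ _
≤-sumℕ {suc t} f (Fin.suc i) rewrite sumℕ-suc f = ℕ.≤-trans (≤-sumℕ (f ∘ Fin.suc) i) (ℕ.m≤n+m _ _)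

sumℕ-topUp : (a c : Fin t → ℕ) → sumℕ a ℕ.≤ sumℕ c →
  ∃ λ a' → (∀ i → a i ℕ.≤ a' i) × sumℕ a' ≡ sumℕ c
sumℕ-topUp {zero}  a c _   = a , (λ ()) , refl
sumℕ-topUp {suc t} a c Σa≤Σc = a' , a≤a' , Σa'≡Σc
  where
  slack = sumℕ c ∸ sumℕ a
  a' : Fin (suc t) → ℕ
  a' Fin.zero    = a Fin.zero ℕ.+ slack
  a' (Fin.suc i) = a (Fin.suc i)
  a≤a' : ∀ i → a i ℕ.≤ a' i
  a≤a' Fin.zero    = ℕ.m≤m+n _ slack
  a≤a' (Fin.suc i) = ℕ.≤-refl
  Σa'≡Σc : sumℕ a' ≡ sumℕ c
  Σa'≡Σc = begin
    sumℕ a'                                      ≡⟨ sumℕ-suc a' ⟩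
    a Fin.zero ℕ.+ slack ℕ.+ sumℕ (a ∘ Fin.suc) ≡⟨ xy∙z≈xz∙y (a Fin.zero) slack _ ⟩
    a Fin.zero ℕ.+ sumℕ (a ∘ Fin.suc) ℕ.+ slack ≡⟨ cong (ℕ._+ slack) (sym (sumℕ-suc a)) ⟩
    sumℕ a ℕ.+ slack                             ≡⟨ ℕ.m+[n∸m]≡n Σa≤Σc ⟩
    sumℕ c                                       ∎
    where
    open ≡-Reasoning
    open CommSemigroupProperties ℕ.+-commutativeSemigroup using (xy∙z≈xz∙y)

sumℚ-mono : {f g : Fin t → ℚ} → (∀ i → f i ≤ g i) → sumℚ f ≤ sumℚ g
sumℚ-mono {zero}          f≤g = ℚ.≤-refl
sumℚ-mono {suc t} {f} {g} f≤g rewrite sumℚ-suc f | sumℚ-suc g =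
  ℚ.+-mono-≤ (f≤g Fin.zero) (sumℚ-mono (f≤g ∘ Fin.suc))

sumℚ-distrib-+ : (f g : Fin t → ℚ) → sumℚ (λ i → f i + g i) ≡ sumℚ f + sumℚ g
sumℚ-distrib-+ {zero}  f g = refl
sumℚ-distrib-+ {suc t} f g
  rewrite sumℚ-suc (λ i → f i + g i) | sumℚ-suc f | sumℚ-suc g
        | sumℚ-distrib-+ (f ∘ Fin.suc) (g ∘ Fin.suc) =
  interchange (f Fin.zero) (g Fin.zero) _ _
  where
  open CommSemigroupProperties (CommutativeMonoid.commutativeSemigroup ℚ.+-0-commutativeMonoid)
    using (interchange)

prefixes-feasible : ∀ {b m} (part : Fin n → Fin t) (g : Fin t → Fin (suc m) → Fin n) (bh : Fin t → ℕ) →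
  (∀ i j → g i j ∈ Part part i) → sumℕ bh ≡ b → Feasible part b (λ i → prefixSet (g i) (suc (bh i)))
prefixes-feasible {b = b} part g bh g∈P Σbh≡b = prefix⊆P , prefix≢∅ , within-budget
  where
  prefix⊆P : ∀ i → prefixSet (g i) (suc (bh i)) ⊆ Part part i
  prefix⊆P i x∈ with ∈-prefixSet⁻ (g i) {suc (bh i)} x∈
  ... | j , _ , refl = g∈P i j
  prefix≢∅ : ∀ i → Nonempty (prefixSet (g i) (suc (bh i)))
  prefix≢∅ i = g i Fin.zero , ∈-prefixSet⁺ (g i) {suc (bh i)} Fin.zero (s≤s z≤n)
  within-budget : sumℕ (λ i → ∣ prefixSet (g i) (suc (bh i)) ∣ ∸ 1) ℕ.≤ b
  within-budget = subst (_ ℕ.≤_) Σbh≡b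
    (sumℕ-mono (λ i → ℕ.∸-monoˡ-≤ 1 (∣prefixSet∣≤ (g i) (suc (bh i)))))

theorem3 : ∀ {n t : ℕ} (d : Fin n → Fin n → ℚ) → IsMetric d →
    (part : Fin n → Fin t) → (∀ i → ∃ λ x → part x ≡ i) →
    (b : ℕ) → (g : Fin t → Fin (suc b) → Fin n) →
    (∀ i → IsGreedy d (Part part i) b (g i)) →
    (bh : Fin t → ℕ) → OptimalAlloc d part b g bh →
    Feasible part b (λ i → prefixSet (g i) (suc (bh i))) ×
    (∀ (R' : Fin t → Subset n) → Feasible part b R' →
      totalCost d part (λ i → prefixSet (g i) (suc (bh i)))
        ≤ totalCost d part R' + totalCost d part R')
theorem3 d metric part part-onto b g greedy bh (Σbh≡b , optimal) =
  prefixes-feasible part g bh (proj₁ ∘ greedy) Σbh≡b , two-approximation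
  where
  Pᵢ≢∅ : ∀ i → Nonempty (Part part i)
  Pᵢ≢∅ i = proj₁ (part-onto i) , ∈-Part part (proj₂ (part-onto i))

  two-approximation : ∀ R' → Feasible part b R' →
    totalCost d part (λ i → prefixSet (g i) (suc (bh i))) ≤ totalCost d part R' + totalCost d part R'
  -- The competitor's sets need not lie inside the parts for this bound.
  two-approximation R' (_ , R'≢∅ , R'-budget)
    with sumℕ-topUp (λ i → ∣ R' i ∣ ∸ 1) bh (subst (_ ℕ.≤_) (sym Σbh≡b) R'-budget)
  ... | bs , R'≤bs , Σbs≡Σbh = begin
    sumℚ (λ i → cHat d part g i (suc (bh i))) ≤⟨ optimal bs Σbs≡b ⟩
    sumℚ (λ i → cHat d part g i (suc (bs i))) ≤⟨ sumℚ-mono per-part ⟩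
    sumℚ (λ i → cost-R' i + cost-R' i)        ≡⟨ sumℚ-distrib-+ cost-R' cost-R' ⟩
    totalCost d part R' + totalCost d part R' ∎
    where
    open ℚ.≤-Reasoning
    Σbs≡b : sumℕ bs ≡ b
    Σbs≡b = trans Σbs≡Σbh Σbh≡b
    cost-R' : Fin _ → ℚ
    cost-R' i = cost d (Part part i) (R' i)
    per-part : ∀ i → cHat d part g i (suc (bs i)) ≤ cost-R' i + cost-R' i
    per-part i = gonzalez-2-approx metric (greedy i) (Pᵢ≢∅ i)
      (s≤s (subst (bs i ℕ.≤_) Σbs≡b (≤-sumℕ bs i))) (R'≢∅ i) (ℕ.≤-trans (ℕ.m≤n+m∸n ∣ R' i ∣ 1) (s≤s (R'≤bs i)))
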